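{- Let $m\ge 2$ and consider the $(q,m-1)$-Calkin-Wilf tree of order $m$. The $(m-1)$-st branch of the root is the sequence $$B_{1/1,m-1}=\left\{\frac{U_j\left(\frac{1}{2\sqrt{ -q}}\right)}{\sqrt{ -q}\,U_{j+1}\left(\frac{1}{2\sqrt{ -q}}\right)}\right\}_{j\geq0}.$$ If $m\geq 3$, then for each $j\in\{1,\dots,m-2\}$ the $j$-th branch of the root is $B_{1/1,j}=\{1/1,\,1/(1+q),\,1/(1+q),\,1/(1+q),\ldots\}$, and the $m$-th branch of the root is $B_{1/1,m}=\{1/1,\,1/(1+q),\,1/(1+q+q^2),\,1/(1+q+q^2+q^3),\ldots\}$.
   Context: For $m\ge3$, the $(q,m-1)$-Calkin-Wilf tree of order $m$ is the infinite complete $m$-ary rooted tree (ordered children: first, ..., $m$-th) with vertices labeled by rational functions of $q$, defined recursively: the root is labeled $\frac11$; for a vertex $v$ with label $\lambda(v)=\frac ab$, each of its first $m-2$ children is labeled $\frac1{1+q}$, its $(m-1)$-st child is labeled $\frac{b}{b+qa}$, and its $m$-th child is labeled $\frac{1}{1+qp\prod_{j=1}^{s}1/\lambda(v_j)}$, where $v_1=v$, $s\ge1$ is maximal such that there are vertices $v_2,\dots,v_s$ with $v_j$ the $(m-1)$-st child of $v_{j+1}$ for $j<s$, and $p=\lambda(v_{s+1})$ if $v_s$ is the $(m-2)$-nd child of a vertex $v_{s+1}$, $p=1$ otherwise. For $m=2$, the $(q,1)$-Calkin-Wilf tree of order $2$ is the binary tree with root labeled $\frac11$ in which the first child of a vertex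 labeled $\frac ab$ is labeled $\frac{b}{b+qa}$, and the second child is labeled by the same rule as the $m$-th child above, except that $p$ is defined as follows: list the vertices level by level, left to right, as $w_0,w_1,w_2,\dots$ (so the children of $w_n$ are $w_{2n+1},w_{2n+2}$); if $v_s$ is the second child of $w_{n'}$ then $p=\lambda(w_{n'+1})$, and $p=1$ otherwise. For a vertex $v$ and $j\in\{1,\dots,m\}$, the $j$-th branch $B_{v,j}$ of $v$ is the sequence of labels of the vertices $v_1=v,v_2,v_3,\ldots$ where $v_i$ is the $j$-th child of $v_{i-1}$ for $i\ge2$. The root's branches are written $B_{1/1,j}$. $U_n$ are the Chebyshev polynomials of the second kind: $U_0(t)=1$, $U_1(t)=2t$, $U_n(t)=2tU_{n-1}(t)-U_{n-2}(t)$ for $n\ge2$. -}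

module Defs where

open import Level using (Level)
open import Algebra.Bundles using (CommutativeRing)
open import Data.Nat using (ℕ; zero; suc; _∸_; _<ᵇ_; _≡ᵇ_; NonZero)
import Data.Nat as N
open import Data.Nat.DivMod using (_/_; _%_)
open import Data.Bool using (Bool; true; false; if_then_else_)
open import Data.Product using (_×_; _,_)

-- A label a/b is stored as the formal fraction (a , b)
-- (numerator , denominator); all rules are written without division.
-- Equality of labels as rational functions is cross-multiplication `_≃_`.
module CW {c ℓ : Level} (R : CommutativeRing c ℓ) where
  open CommutativeRing R hiding (zero)

  Frac : Set c
  Frac = Carrier × Carrier

  _≃_ : Frac → Frac → Set ℓ
  (a , b) ≃ (x , y) = a * y ≈ b * x

  oneF : Frac
  oneF = 1# , 1#

  invF : Frac → Frac
  invF (a , b) = b , a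

  mulF : Frac → Frac → Frac
  mulF (a , b) (x , y) = a * x , b * y

  two : Carrier
  two = 1# + 1#

  U : Carrier → ℕ → Carrier
  U t zero = 1#
  U t (suc zero) = two * t
  U t (suc (suc n)) = two * t * U t (suc n) - U t n

  pow : Carrier → ℕ → Carrier
  pow x zero = 1#
  pow x (suc n) = x * pow x n

  geom : Carrier → ℕ → Carrier
  geom q zero = 1#
  geom q (suc i) = geom q i + pow q (suc i)

  constDen : Carrier → ℕ → Carrier
  constDen q zero = 1#
  constDen q (suc i) = 1# + q

  -- Vertices are numbered in level order w_0, w_1, ...
  -- (root w_0; the children of w_n are w_{mn+1}, ..., w_{mn+m}).
  -- Child positions are 0-based here: position c means the (c+1)-st child.
  module Tree (m : ℕ) .{{_ : NonZero m}} (q : Carrier) where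

    parent : ℕ → ℕ
    parent n = (n ∸ 1) / m

    pos : ℕ → ℕ
    pos n = (n ∸ 1) % m

    -- walk up from v_1 = v through (m-1)-st children, accumulating
    -- the product of 1/λ(v_j); returns the product and (the index of) v_s.
    -- The fuel argument (≥ the index of v) is always sufficient.
    chain : (ℕ → Frac) → ℕ → ℕ → Frac → Frac × ℕ
    chain T zero v acc = acc , v
    chain T (suc f) zero acc = acc , zero
    chain T (suc f) (suc v) acc =
      if pos (suc v) ≡ᵇ (m ∸ 2)
        then chain T f (parent (suc v)) (mulF acc (invF (T (parent (suc v)))))
        else (acc , suc v)

    pval : (ℕ → Frac) → ℕ → Frac
    pval T zero = oneF
    pval T (suc v) =
      if m ≡ᵇ 2
        then T (parent (suc v) N.+ 1)          -- m = 2: v_s is 2nd child of w_n', p = λ(w_{n'+1})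
        else (if pos (suc v) ≡ᵇ (m ∸ 3)        -- m ≥ 3: v_s is the (m-2)-nd child of v_{s+1}
                then T (parent (suc v))
                else oneF)

    -- label of the m-th child of v : 1 / (1 + q p ∏ 1/λ(v_j))
    mthChild : (ℕ → Frac) → ℕ → Frac
    mthChild T v with chain T v v (invF (T v))
    ... | (Pn , Pd) , vs with pval T vs
    ...   | (pn , pd) = pd * Pd , pd * Pd + q * (pn * Pn)

    -- (m-1)-st child of a vertex labeled a/b : b/(b+qa)
    cwChild : Frac → Frac
    cwChild (a , b) = b , b + q * a

    childLabel : (ℕ → Frac) → ℕ → ℕ → Frac
    childLabel T v c =
      if c <ᵇ (m ∸ 2)
        then (1# , 1# + q)
        else (if c ≡ᵇ (m ∸ 2)
                then cwChild (T v)
                else mthChild T v)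

    newLabel : ℕ → (ℕ → Frac) → Frac
    newLabel zero T = oneF
    newLabel (suc n) T = childLabel T (parent (suc n)) (pos (suc n))

    -- tab k i = λ(w_i) for i < k
    tab : ℕ → ℕ → Frac
    tab zero i = oneF
    tab (suc k) i = if i <ᵇ k then tab k i else newLabel k (tab k)

    label : ℕ → Frac
    label n = tab (suc n) n

    -- level-order index of the i-th vertex of the j-th branch of the root
    -- (j is 1-based: the j-th child of w_n is w_{mn+j})
    branchVertex : ℕ → ℕ → ℕ
    branchVertex j zero = zero
    branchVertex j (suc i) = m N.* branchVertex j i N.+ j

    -- B_{1/1,j} as a sequence indexed from 0
    branch : ℕ → ℕ → Frac
    branch j i = label (branchVertex j i)

-- Each branch of the root is the orbit of 1/1 under a single map, since each of its vertices is
-- the same child of the previous one: the constant 1/(1+q) on the first m-2 branches,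
-- a/b ↦ b/(b+qa) on the (m-1)-st, and a/b ↦ a/(a+qb) on the m-th, because an m-th child is neither
-- an (m-1)-st child nor (for m ≥ 3) an (m-2)-nd one, so its chain is trivial and p = 1.
-- With q = -s² and 2st = 1 (that is, s = √-q and t = 1/(2s)), the map a/b ↦ b/(b+qa) sends
-- s^i U_i / s^(i+1) U_(i+1) to the next such quotient by the Chebyshev recurrence, while
-- a/b ↦ a/(a+qb) sends 1/(1+q+⋯+q^i) to 1/(1+q+⋯+q^(i+1)) by Horner's rule.
module Submission where

open import Defs
open import Level using (Level)
open import Algebra.Bundles using (CommutativeRing)
open import Data.Nat using (ℕ; zero; suc; _∸_; _≤_; NonZero)
open import Data.Product using (_×_; _,_)

import Algebra.Properties.Ring as RingProperties
import Algebra.Solver.Ring.NaturalCoefficients.Default as NaturalSolver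
open import Data.Bool using (Bool; true; false; T; if_then_else_)
import Data.Nat as N
open import Data.Nat using (_<_; _<ᵇ_; _≡ᵇ_; z≤n; s≤s; z<s)
open import Data.Nat.DivMod using (_/_; _%_; +-distrib-/-∣ʳ; m<n⇒m/n≡0; m*n/n≡m; [m+kn]%n≡m%n; m<n⇒m%n≡m)
open import Data.Nat.Divisibility using (n∣m*n)
open import Data.Nat.GeneralisedArithmetic using (fold)
import Data.Nat.Properties as NP
open import Data.Product using (proj₁; proj₂)
open import Data.Sum using (inj₁; inj₂)
open import Relation.Binary.PropositionalEquality using (_≡_; _≢_; refl; cong; cong₂; subst; sym; trans; module ≡-Reasoning)
open import Relation.Nullary using (contradiction)

<ᵇ-true : ∀ {m n} → m < n → (m <ᵇ n) ≡ true
<ᵇ-true z<s = refl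
<ᵇ-true {suc m} {suc n} (s≤s m<n) = <ᵇ-true m<n

<ᵇ-false : ∀ {m n} → n ≤ m → (m <ᵇ n) ≡ false
<ᵇ-false z≤n = refl
<ᵇ-false (s≤s n≤m) = <ᵇ-false n≤m

≡ᵇ-refl : ∀ n → (n ≡ᵇ n) ≡ true
≡ᵇ-refl zero = refl
≡ᵇ-refl (suc n) = ≡ᵇ-refl n

≡ᵇ-false : ∀ {m n} → m ≢ n → (m ≡ᵇ n) ≡ false
≡ᵇ-false {m} {n} m≢n with m ≡ᵇ n in eq
... | false = refl
... | true = contradiction (NP.≡ᵇ⇒≡ m n (subst T (sym eq) _)) m≢n

if-false : ∀ {a} {A : Set a} {b : Bool} {x y : A} → b ≡ false → (if b then x else y) ≡ y
if-false refl = refl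

module _ (m : ℕ) .{{_ : NonZero m}} (n : ℕ) {o : ℕ} (o<m : o < m) where
  open ≡-Reasoning

  private
    m*n+o≡o+n*m : m N.* n N.+ o ≡ o N.+ n N.* m
    m*n+o≡o+n*m = trans (NP.+-comm (m N.* n) o) (cong (o N.+_) (NP.*-comm m n))

  [m*n+o]/m≡n : (m N.* n N.+ o) / m ≡ n
  [m*n+o]/m≡n = begin
    (m N.* n N.+ o) / m     ≡⟨ cong (_/ m) m*n+o≡o+n*m ⟩
    (o N.+ n N.* m) / m     ≡⟨ +-distrib-/-∣ʳ o (n∣m*n n) ⟩
    o / m N.+ n N.* m / m   ≡⟨ cong₂ N._+_ (m<n⇒m/n≡0 o<m) (m*n/n≡m n m) ⟩
    n                       ∎

  [m*n+o]%m≡o : (m N.* n N.+ o) % m ≡ o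
  [m*n+o]%m≡o = begin
    (m N.* n N.+ o) % m     ≡⟨ cong (_% m) m*n+o≡o+n*m ⟩
    (o N.+ n N.* m) % m     ≡⟨ [m+kn]%n≡m%n o n m ⟩
    o % m                   ≡⟨ m<n⇒m%n≡m o<m ⟩
    o                       ∎

module Fractions {c ℓ : Level} (R : CommutativeRing c ℓ) where
  open CommutativeRing R hiding (zero; refl; sym; trans)
  open CommutativeRing R using () renaming (refl to ≈-refl; sym to ≈-sym; trans to ≈-trans)
  open CW R
  open RingProperties ring using (-‿distribˡ-*; x[y-z]≈xy-xz)
  open NaturalSolver commutativeSemiring using (solve; _:*_; _:+_; _:=_)
  open import Relation.Binary.Reasoning.Setoid setoid

  cwStep : Carrier → Frac → Frac
  cwStep q (a , b) = b , b + q * a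

  -- The m-th child of a/b when the chain of (m-1)-st children is trivial and p = 1/1;
  -- the factors 1# are the numerator and denominator of p.
  trivialChainStep : Carrier → Frac → Frac
  trivialChainStep q (a , b) = 1# * a , 1# * a + q * (1# * b)

  ≃-from-≈ : ∀ {a b x y} → a ≈ x → b ≈ y → (a , b) ≃ (x , y)
  ≃-from-≈ {a} {b} {x} {y} a≈x b≈y = begin
    a * y  ≈⟨ *-congʳ a≈x ⟩
    x * y  ≈⟨ *-comm x y ⟩
    y * x  ≈⟨ *-congʳ b≈y ⟨
    b * x  ∎

  ≃-from-scaled : ∀ {a b x y} k → a ≈ k * x → b ≈ k * y → (a , b) ≃ (x , y)
  ≃-from-scaled {a} {b} {x} {y} k a≈kx b≈ky = begin
    a * y        ≈⟨ *-congʳ a≈kx ⟩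
    k * x * y    ≈⟨ solve 3 (λ k x y → k :* x :* y := k :* y :* x) ≈-refl k x y ⟩
    k * y * x    ≈⟨ *-congʳ b≈ky ⟨
    b * x        ∎

  geom-horner : ∀ q i → 1# + q * geom q i ≈ geom q (suc i)
  geom-horner q zero = ≈-refl
  geom-horner q (suc i) = begin
    1# + q * (geom q i + pow q (suc i))      ≈⟨ distrib-+ 1# q (geom q i) (pow q (suc i)) ⟩
    (1# + q * geom q i) + q * pow q (suc i)  ≈⟨ +-congʳ (geom-horner q i) ⟩
    geom q (suc i) + pow q (suc (suc i))     ∎
    where
    distrib-+ : ∀ o q g x → o + q * (g + x) ≈ (o + q * g) + q * x
    distrib-+ = solve 4 (λ o q g x → o :+ q :* (g :+ x) := (o :+ q :* g) :+ q :* x) ≈-refl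

  module _ {s t : Carrier} (2st≈1 : two * s * t ≈ 1#) where
    private
      B : ℕ → Frac
      B = fold oneF (cwStep (- (s * s)))

      scaled-recurrence : ∀ w P V W → w * s * t * (s * P * V) + - (s * s) * (P * W) ≈ s * (s * P) * (w * t * V - W)
      scaled-recurrence w P V W = ≈-sym (begin
        s * (s * P) * (w * t * V - W)                   ≈⟨ x[y-z]≈xy-xz _ _ _ ⟩
        s * (s * P) * (w * t * V) - s * (s * P) * W     ≈⟨ +-cong (first-term w s t P V) (-‿cong (second-term s P W)) ⟩
        w * s * t * (s * P * V) - s * s * (P * W)       ≈⟨ +-congˡ (-‿distribˡ-* _ _) ⟩
        w * s * t * (s * P * V) + - (s * s) * (P * W)   ∎)
        where
        first-term : ∀ w s t P V → s * (s * P) * (w * t * V) ≈ w * s * t * (s * P * V)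
        first-term = solve 5 (λ w s t P V → s :* (s :* P) :* (w :* t :* V) := w :* s :* t :* (s :* P :* V)) ≈-refl
        second-term : ∀ s P W → s * (s * P) * W ≈ s * s * (P * W)
        second-term = solve 3 (λ s P W → s :* (s :* P) :* W := s :* s :* (P :* W)) ≈-refl

    cwStep-chebyshev-invariant : ∀ i → proj₁ (B i) ≈ pow s i * U t i × proj₂ (B i) ≈ pow s (suc i) * U t (suc i)
    cwStep-chebyshev-invariant zero = ≈-sym (*-identityˡ 1#) , ≈-sym (begin
      s * 1# * (two * t)  ≈⟨ *-congʳ (*-identityʳ s) ⟩
      s * (two * t)       ≈⟨ solve 3 (λ s w t → s :* (w :* t) := w :* s :* t) ≈-refl s two t ⟩
      two * s * t         ≈⟨ 2st≈1 ⟩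
      1#                  ∎)
    cwStep-chebyshev-invariant (suc i) with cwStep-chebyshev-invariant i
    ... | a≈ , b≈ = b≈ , (begin
      b + - (s * s) * a                                   ≈⟨ +-cong b≈ (*-congˡ a≈) ⟩
      s * P * V + - (s * s) * (P * W)                     ≈⟨ +-congʳ (*-identityˡ _) ⟨
      1# * (s * P * V) + - (s * s) * (P * W)              ≈⟨ +-congʳ (*-congʳ 2st≈1) ⟨
      two * s * t * (s * P * V) + - (s * s) * (P * W)     ≈⟨ scaled-recurrence two P V W ⟩
      s * (s * P) * (two * t * V - W)                     ∎)
      where
      a b P V W : Carrier
      a = proj₁ (B i)
      b = proj₂ (B i)
      P = pow s i
      V = U t (suc i)
      W = U t i

    cwStep-chebyshev : ∀ i → B i ≃ (U t i , s * U t (suc i))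
    cwStep-chebyshev i with cwStep-chebyshev-invariant i
    ... | a≈ , b≈ = ≃-from-scaled (pow s i) a≈
          (≈-trans b≈ (solve 3 (λ s P V → s :* P :* V := P :* (s :* V)) ≈-refl s (pow s i) (U t (suc i))))

  module _ (q : Carrier) where
    private
      B : ℕ → Frac
      B = fold oneF (trivialChainStep q)

    trivialChainStep-geom-invariant : ∀ i → proj₁ (B i) ≈ 1# × proj₂ (B i) ≈ geom q i
    trivialChainStep-geom-invariant zero = ≈-refl , ≈-refl
    trivialChainStep-geom-invariant (suc i) with trivialChainStep-geom-invariant i
    ... | a≈1 , b≈g = 1a≈1 , ≈-trans (+-cong 1a≈1 (*-congˡ 1b≈g)) (geom-horner q i)
      where
      1a≈1 : 1# * proj₁ (B i) ≈ 1#
      1a≈1 = ≈-trans (*-identityˡ _) a≈1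
      1b≈g : 1# * proj₂ (B i) ≈ geom q i
      1b≈g = ≈-trans (*-identityˡ _) b≈g

    trivialChainStep-geom : ∀ i → B i ≃ (1# , geom q i)
    trivialChainStep-geom i with trivialChainStep-geom-invariant i
    ... | a≈1 , b≈g = ≃-from-≈ a≈1 b≈g

module TreeLabels {c ℓ : Level} (R : CommutativeRing c ℓ) (m : ℕ) .{{_ : NonZero m}} (q : CommutativeRing.Carrier R) where
  open CommutativeRing R using (1#; _+_)
  open CW R
  open Tree m q
  open Fractions R using (cwStep; trivialChainStep)
  open ≡-Reasoning

  label≡newLabel : ∀ n → label n ≡ newLabel n (tab n)
  label≡newLabel n rewrite <ᵇ-false (NP.≤-refl {n}) = refl

  tab≡label : ∀ {k i} → i < k → tab k i ≡ label i
  tab≡label {suc k} {i} i<1+k with i <ᵇ k in eq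
  ... | true = tab≡label (NP.<ᵇ⇒< i k (subst T (sym eq) _))
  ... | false with NP.m<1+n⇒m<n∨m≡n i<1+k
  ...   | inj₁ i<k = contradiction (trans (sym (<ᵇ-true i<k)) eq) λ ()
  ...   | inj₂ refl = sym (label≡newLabel i)

  parent<child : ∀ v j → v < m N.* v N.+ suc j
  parent<child v j = NP.≤-<-trans (NP.m≤n*m v m) (NP.m<m+n (m N.* v) z<s)

  label-child : ∀ v {j} → j < m → label (m N.* v N.+ suc j) ≡ childLabel (tab (m N.* v N.+ suc j)) v j
  label-child v {j} j<m rewrite NP.+-suc (m N.* v) j =
    trans (label≡newLabel (suc n)) (cong₂ (childLabel (tab (suc n))) ([m*n+o]/m≡n m v j<m) ([m*n+o]%m≡o m v j<m))
    where
    n : ℕ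
    n = m N.* v N.+ j

  childLabel-first : ∀ F v {j} → j < m ∸ 2 → childLabel F v j ≡ (1# , 1# + q)
  childLabel-first F v j<m-2 rewrite <ᵇ-true j<m-2 = refl

  childLabel-penultimate : ∀ F v → childLabel F v (m ∸ 2) ≡ cwStep q (F v)
  childLabel-penultimate F v rewrite <ᵇ-false (NP.≤-refl {m ∸ 2}) | ≡ᵇ-refl (m ∸ 2) = refl

  childLabel-last : ∀ F v → childLabel F v (suc (m ∸ 2)) ≡ mthChild F v
  childLabel-last F v rewrite <ᵇ-false (NP.n≤1+n (m ∸ 2)) | ≡ᵇ-false (NP.>⇒≢ (NP.n<1+n (m ∸ 2))) = refl

  mthChild-trivial : ∀ F v → chain F v v (invF (F v)) ≡ (invF (F v) , v) → pval F v ≡ oneF →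
                     mthChild F v ≡ trivialChainStep q (F v)
  mthChild-trivial F v chain≡ pval≡ rewrite chain≡ | pval≡ = refl

  branch-first≡ : ∀ {j} → j < m ∸ 2 → ∀ i → branch (suc j) (suc i) ≡ (1# , 1# + q)
  branch-first≡ {j} j<m-2 i =
    trans (label-child v (NP.<-≤-trans j<m-2 (NP.m∸n≤m m 2))) (childLabel-first (tab (m N.* v N.+ suc j)) v j<m-2)
    where
    v : ℕ
    v = branchVertex (suc j) i

  branch-penultimate≡fold : m ∸ 2 < m → ∀ i → branch (suc (m ∸ 2)) i ≡ fold oneF (cwStep q) i
  branch-penultimate≡fold m-2<m zero = refl
  branch-penultimate≡fold m-2<m (suc i) = begin
    label (m N.* v N.+ suc (m ∸ 2))      ≡⟨ label-child v m-2<m ⟩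
    childLabel F v (m ∸ 2)               ≡⟨ childLabel-penultimate F v ⟩
    cwStep q (F v)                       ≡⟨ cong (cwStep q) (tab≡label (parent<child v (m ∸ 2))) ⟩
    cwStep q (label v)                   ≡⟨ cong (cwStep q) (branch-penultimate≡fold m-2<m i) ⟩
    cwStep q (fold oneF (cwStep q) i)    ∎
    where
    v : ℕ
    v = branchVertex (suc (m ∸ 2)) i
    F : ℕ → Frac
    F = tab (m N.* v N.+ suc (m ∸ 2))

module LastBranch {c ℓ : Level} (R : CommutativeRing c ℓ) (k : ℕ) (q : CommutativeRing.Carrier R) where
  open CW R
  open Tree (suc (suc (suc k))) q
  open TreeLabels R (suc (suc (suc k))) q
  open Fractions R using (trivialChainStep)
  open ≡-Reasoning

  private
    m : ℕ
    m = suc (suc (suc k))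

  mthChild-of-mthChild : ∀ F v → mthChild F (m N.* v N.+ m) ≡ trivialChainStep q (F (m N.* v N.+ m))
  mthChild-of-mthChild F v rewrite NP.+-suc (m N.* v) (suc (suc k)) =
    mthChild-trivial F (suc w)
      (if-false (trans (cong (_≡ᵇ suc k) pos≡) (≡ᵇ-false (NP.>⇒≢ (NP.n<1+n (suc k))))))
      (if-false (trans (cong (_≡ᵇ k) pos≡) (≡ᵇ-false (NP.>⇒≢ (NP.m<n+m k {2} z<s)))))
    where
    w : ℕ
    w = m N.* v N.+ suc (suc k)
    pos≡ : pos (suc w) ≡ suc (suc k)
    pos≡ = [m*n+o]%m≡o m v (NP.n<1+n (suc (suc k)))

  mthChild-on-branch : ∀ F i → mthChild F (branchVertex m i) ≡ trivialChainStep q (F (branchVertex m i))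
  mthChild-on-branch F zero = refl
  mthChild-on-branch F (suc i) = mthChild-of-mthChild F (branchVertex m i)

  branch-last≡fold : ∀ i → branch m i ≡ fold oneF (trivialChainStep q) i
  branch-last≡fold zero = refl
  branch-last≡fold (suc i) = begin
    label (m N.* v N.+ m)                                  ≡⟨ label-child v (NP.n<1+n (suc (suc k))) ⟩
    childLabel F v (suc (suc k))                           ≡⟨ childLabel-last F v ⟩
    mthChild F v                                           ≡⟨ mthChild-on-branch F i ⟩
    trivialChainStep q (F v)                               ≡⟨ cong (trivialChainStep q) (tab≡label v<child) ⟩
    trivialChainStep q (label v)                           ≡⟨ cong (trivialChainStep q) (branch-last≡fold i) ⟩
    trivialChainStep q (fold oneF (trivialChainStep q) i)  ∎
    where
    v : ℕ
    v = branchVertex m i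
    v<child : v < m N.* v N.+ m
    v<child = parent<child v (suc (suc k))
    F : ℕ → Frac
    F = tab (m N.* v N.+ m)

module _ {c ℓ : Level} (R : CommutativeRing c ℓ) where
  open CommutativeRing R hiding (zero; refl; sym; trans)
  open CommutativeRing R using () renaming (refl to ≈-refl)
  open CW R
  open Fractions R

  branch-penultimate-chebyshev : (m : ℕ) .{{_ : NonZero m}} → 2 ≤ m → (s t : Carrier) → two * s * t ≈ 1# →
                                 ∀ i → Tree.branch m (- (s * s)) (m ∸ 1) i ≃ (U t i , s * U t (suc i))
  branch-penultimate-chebyshev (suc (suc k)) (s≤s (s≤s z≤n)) s t 2st≈1 i =
    subst (_≃ (U t i , s * U t (suc i)))
          (sym (TreeLabels.branch-penultimate≡fold R (suc (suc k)) (- (s * s)) (NP.m<n+m k z<s) i))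
          (cwStep-chebyshev 2st≈1 i)

  branch-first-constant : (m : ℕ) .{{_ : NonZero m}} (q : Carrier) →
                          ∀ j → 1 ≤ j → j ≤ m ∸ 2 → ∀ i → Tree.branch m q j i ≃ (1# , constDen q i)
  branch-first-constant m q (suc j) _ j<m-2 zero = ≃-from-≈ ≈-refl ≈-refl
  branch-first-constant m q (suc j) _ j<m-2 (suc i) =
    subst (_≃ (1# , 1# + q)) (sym (TreeLabels.branch-first≡ R m q j<m-2 i)) (≃-from-≈ ≈-refl ≈-refl)

  branch-last-geom : (m : ℕ) .{{_ : NonZero m}} → 3 ≤ m → (q : Carrier) →
                     ∀ i → Tree.branch m q m i ≃ (1# , geom q i)
  branch-last-geom (suc (suc (suc k))) (s≤s (s≤s (s≤s z≤n))) q i =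
    subst (_≃ (1# , geom q i)) (sym (LastBranch.branch-last≡fold R k q i)) (trivialChainStep-geom q i)

mainTheorem3 : {c ℓ : Level} (R : CommutativeRing c ℓ) (m : ℕ) .{{_ : NonZero m}} → 2 ≤ m →
    let open CommutativeRing R hiding (zero)
        open CW R
    in ((s t : Carrier) → (1# + 1#) * s * t ≈ 1# →
          (i : ℕ) → Tree.branch m (- (s * s)) (m ∸ 1) i ≃ (U t i , s * U t (suc i)))
       × (3 ≤ m → (q : Carrier) →
          ((j : ℕ) → 1 ≤ j → j ≤ m ∸ 2 → (i : ℕ) →
              Tree.branch m q j i ≃ (1# , constDen q i))
          × ((i : ℕ) → Tree.branch m q m i ≃ (1# , geom q i)))
mainTheorem3 R m 2≤m =
  branch-penultimate-chebyshev R m 2≤m ,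
  λ 3≤m q → branch-first-constant R m q , branch-last-geom R m 3≤m q
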